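{- Let $p\ge 5$ be an odd prime, let $x$ be a generator of the multiplicative group $\mathbb{Z}_p^*$ and $y = x^{ -1}$ in $\mathbb{Z}_p^*$. Let $\mathcal{I} = \mathbb{Z}_p \times \mathbb{Z}_p$. For $(a,b)\in\mathcal{I}$ define the permutation $\pi_{(a,b)}$ of $\mathcal{I}$ by \[ \pi_{(a,b)}((c,d)) = \begin{cases} (a, a+b+d) & \text{if } c=0 \text{ and } a+b+d\ne 0,\\ (a+xb, 0) & \text{if } c=0 \text{ and } a+b+d=0,\\ (a+c+xb, 0) & \text{if } c\ne 0 \text{ and } b+d=0,\\ (a+c, b+d) & \text{if } c\ne 0 \text{ and } b+d\ne 0,\end{cases} \] and define $\pi((c,d)) = (yc, xd)$. Let $M_{(a,b)}$ and $M$ be the perfect matchings of $K_{p^2,p^2}$ (both sides labelled by $\mathcal{I}$) with edge sets $\{(c,d)\mapsto \pi_{(a,b)}((c,d))\}$ and $\{(c,d)\mapsto \pi((c,d))\}$ respectively. Then for every $(a,b)\in\mathcal{I}$ we have $|M\cap M_{(a,b)}| = 1$; equivalently, there is exactly one $(c,d)\in\mathcal{I}$ with $\pi_{(a,b)}((c,d)) = \pi((c,d))$.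
   Context: All arithmetic is in $\mathbb{Z}_p$. The vertices on each side of $K_{p^2,p^2}$ are labelled by elements of $\mathcal{I}$, and $(u\mapsto v)$ denotes the edge joining the vertex labelled $u$ on one side to the vertex labelled $v$ on the other side. -}

module Defs where

open import Data.Nat using (ℕ; zero; suc; NonZero)
import Data.Nat as ℕ
open import Data.Nat.DivMod using (_mod_)
open import Data.Fin using (Fin; toℕ)
open import Data.Product using (_×_; _,_)
import Data.Product
open import Relation.Binary.PropositionalEquality using (_≡_)
open import Relation.Nullary using (¬_; Dec; yes; no)
open import Data.Fin.Properties using (_≟_)

module Zp (p : ℕ) .{{_ : NonZero p}} where

  Z : Set
  Z = Fin p

  0ₚ : Z
  0ₚ = 0 mod p

  1ₚ : Z
  1ₚ = 1 mod p

  infixl 6 _+ₚ_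
  infixl 7 _*ₚ_

  _+ₚ_ : Z → Z → Z
  a +ₚ b = (toℕ a ℕ.+ toℕ b) mod p

  _*ₚ_ : Z → Z → Z
  a *ₚ b = (toℕ a ℕ.* toℕ b) mod p

  _^ₚ_ : Z → ℕ → Z
  a ^ₚ zero = 1ₚ
  a ^ₚ suc k = a *ₚ (a ^ₚ k)

  IsGenerator : Z → Set
  IsGenerator x = ¬ (x ≡ 0ₚ) × (∀ (z : Z) → ¬ (z ≡ 0ₚ) → Data.Product.∃ λ k → x ^ₚ k ≡ z)

  I : Set
  I = Z × Z

  πab : Z → I → I → I
  πab x (a , b) (c , d) with c ≟ 0ₚ | (a +ₚ b +ₚ d) ≟ 0ₚ | (b +ₚ d) ≟ 0ₚ
  ... | yes _ | no _  | _     = (a , a +ₚ b +ₚ d)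
  ... | yes _ | yes _ | _     = (a +ₚ x *ₚ b , 0ₚ)
  ... | no _  | _     | yes _ = (a +ₚ c +ₚ x *ₚ b , 0ₚ)
  ... | no _  | _     | no _  = (a +ₚ c , b +ₚ d)

  π : Z → Z → I → I
  π x y (c , d) = (y *ₚ c , x *ₚ d)

-- Comparing coordinates in each of the four cases of π_(a,b) shows that π_(a,b)(c,d) = π(c,d)
-- holds exactly when a + c = y c and b + d = x d: in the three exceptional cases either side
-- forces the specially treated coordinates to vanish, because x ≢ 0 and x ≢ 1.  Since a generator
-- x and its inverse y are both ≢ 1, each equation (z − 1) t = e has exactly one solution in the
-- field ℤ_p, so exactly one vertex (c,d) is matched alike by M and M_(a,b).
module Submission where

open import Defs
open import Data.Nat using (ℕ; _≤_; NonZero)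
open import Data.Nat.Primality using (Prime)
open import Data.Product using (∃!; _,_)
open import Relation.Binary.PropositionalEquality using (_≡_)

open import Data.Nat using (zero; suc; _+_; _*_; _∸_; _<_; _%_; _/_; z≤n; s≤s; >-nonZero⁻¹; ≢-nonZero)
open import Data.Nat.Properties
  using (+-assoc; +-comm; +-identityʳ; +-suc; *-assoc; *-comm; *-identityˡ; *-identityʳ; *-zeroʳ;
         m+[n∸m]≡n; <⇒≤; <-trans; ≤-trans)
open import Data.Nat.DivMod
  using (_mod_; m%n<n; m%n%n≡m%n; m<n⇒m%n≡m; %-distribˡ-+; %-distribˡ-*; [m+n]%n≡m%n; [m+kn]%n≡m%n;
         m*n%n≡0; n%n≡0; m≡m%n+[m/n]*n)
open import Data.Nat.Coprimality using (prime⇒coprime; coprime-Bézout)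
open import Data.Nat.GCD using (module Bézout)
open import Data.Nat.Solver using (module +-*-Solver)
open import Data.Fin using (toℕ)
open import Data.Fin.Properties using (_≟_; toℕ-injective; toℕ-fromℕ<; toℕ<n)
open import Data.Product using (∃; _×_; proj₁; proj₂; map₂)
open import Data.Product.Properties using (×-≡,≡←≡; ×-≡,≡→≡)
open import Function.Bundles using (_⇔_; mk⇔; Equivalence)
open import Function.Properties.Equivalence using () renaming (trans to ⇔-trans)
open import Relation.Nullary using (¬_; yes; no)
open import Relation.Binary.Bundles using (Setoid)
import Relation.Binary.Construct.On as On
import Relation.Binary.Reasoning.Setoid as SetoidReasoning
open import Relation.Binary.PropositionalEquality
  using (refl; sym; trans; cong; cong₂; setoid; module ≡-Reasoning)

,≡,⇔ : ∀ {A B : Set} {a₁ a₂ : A} {b₁ b₂ : B} → (a₁ , b₁) ≡ (a₂ , b₂) ⇔ (a₁ ≡ a₂ × b₁ ≡ b₂)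
,≡,⇔ = mk⇔ ×-≡,≡←≡ ×-≡,≡→≡

∃!-× : ∀ {A B : Set} {P : A → Set} {Q : B → Set} →
       ∃! _≡_ P → ∃! _≡_ Q → ∃! _≡_ (λ uv → P (proj₁ uv) × Q (proj₂ uv))
∃!-× (u , Pu , u-unique) (v , Qv , v-unique) =
  (u , v) , (Pu , Qv) , λ (Pu′ , Qv′) → cong₂ _,_ (u-unique Pu′) (v-unique Qv′)

∃!-⇔ : ∀ {A : Set} {P Q : A → Set} → (∀ u → P u ⇔ Q u) → ∃! _≡_ Q → ∃! _≡_ P
∃!-⇔ P⇔Q (u , Qu , u-unique) =
  u , Equivalence.from (P⇔Q u) Qu , λ {v} Pv → u-unique (Equivalence.to (P⇔Q v) Pv)

module Congruence (p : ℕ) .{{_ : NonZero p}} where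

  infix 4 _≈_
  _≈_ : ℕ → ℕ → Set
  m ≈ n = m % p ≡ n % p

  ≈-setoid : Setoid _ _
  ≈-setoid = On.setoid (setoid ℕ) (_% p)

  module ≈-Reasoning = SetoidReasoning ≈-setoid

  +-cong : ∀ {m m′ n n′} → m ≈ m′ → n ≈ n′ → m + n ≈ m′ + n′
  +-cong {m} {m′} {n} {n′} m≈m′ n≈n′ = begin
    (m + n) % p           ≡⟨ %-distribˡ-+ m n p ⟩
    (m % p + n % p) % p   ≡⟨ cong₂ (λ u v → (u + v) % p) m≈m′ n≈n′ ⟩
    (m′ % p + n′ % p) % p ≡⟨ %-distribˡ-+ m′ n′ p ⟨
    (m′ + n′) % p         ∎
    where open ≡-Reasoning

  *-cong : ∀ {m m′ n n′} → m ≈ m′ → n ≈ n′ → m * n ≈ m′ * n′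
  *-cong {m} {m′} {n} {n′} m≈m′ n≈n′ = begin
    (m * n) % p           ≡⟨ %-distribˡ-* m n p ⟩
    (m % p * (n % p)) % p ≡⟨ cong₂ (λ u v → (u * v) % p) m≈m′ n≈n′ ⟩
    (m′ % p * (n′ % p)) % p ≡⟨ %-distribˡ-* m′ n′ p ⟨
    (m′ * n′) % p         ∎
    where open ≡-Reasoning

  0%p≡0 : 0 % p ≡ 0
  0%p≡0 = m*n%n≡0 0 p

  p≈0 : p ≈ 0
  p≈0 = trans (n%n≡0 p) (sym 0%p≡0)

  -- p ∸ m % p plays the role of −m; the subtraction never truncates since m % p < p.
  +-inverseʳ : ∀ m → m + (p ∸ m % p) ≈ 0
  +-inverseʳ m = trans (cong (_% p) m+[p∸m%p]≡[1+m/p]*p) ([m+kn]%n≡m%n 0 (suc (m / p)) p)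
    where
    open ≡-Reasoning
    open +-*-Solver
    r = m % p
    q = m / p
    m+[p∸m%p]≡[1+m/p]*p : m + (p ∸ r) ≡ suc q * p
    m+[p∸m%p]≡[1+m/p]*p = begin
      m + (p ∸ r)               ≡⟨ cong (_+ (p ∸ r)) (m≡m%n+[m/n]*n m p) ⟩
      r + q * p + (p ∸ r)       ≡⟨ solve 3 (λ r qp p∸r → r :+ qp :+ p∸r := r :+ p∸r :+ qp) refl r (q * p) (p ∸ r) ⟩
      r + (p ∸ r) + q * p       ≡⟨ cong (_+ q * p) (m+[n∸m]≡n (<⇒≤ (m%n<n m p))) ⟩
      p + q * p                 ∎

  +-cancelʳ : ∀ {m n} o → m + o ≈ n + o → m ≈ n
  +-cancelʳ {m} {n} o m+o≈n+o = begin
    m                   ≈⟨ m+o+ō≈m m ⟨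
    m + o + (p ∸ o % p) ≈⟨ +-cong m+o≈n+o refl ⟩
    n + o + (p ∸ o % p) ≈⟨ m+o+ō≈m n ⟩
    n                   ∎
    where
    open ≈-Reasoning
    m+o+ō≈m : ∀ k → k + o + (p ∸ o % p) ≈ k
    m+o+ō≈m k = begin
      k + o + (p ∸ o % p)   ≡⟨ +-assoc k o _ ⟩
      k + (o + (p ∸ o % p)) ≈⟨ +-cong {k} refl (+-inverseʳ o) ⟩
      k + 0                 ≡⟨ +-identityʳ k ⟩
      k                     ∎

  1+p∸1≡p : 1 + (p ∸ 1) ≡ p
  1+p∸1≡p = m+[n∸m]≡n (>-nonZero⁻¹ p)

  1+n≈0⇒[p∸1]*n≈1 : ∀ {n} → 1 + n ≈ 0 → (p ∸ 1) * n ≈ 1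
  1+n≈0⇒[p∸1]*n≈1 {n} 1+n≈0 = +-cancelʳ (p ∸ 1) (begin
    (p ∸ 1) * n + (p ∸ 1) ≡⟨ solve 2 (λ q n → q :* n :+ q := q :* (con 1 :+ n)) refl (p ∸ 1) n ⟩
    (p ∸ 1) * (1 + n)     ≈⟨ *-cong {p ∸ 1} refl 1+n≈0 ⟩
    (p ∸ 1) * 0           ≡⟨ *-zeroʳ (p ∸ 1) ⟩
    0                     ≈⟨ p≈0 ⟨
    p                     ≡⟨ 1+p∸1≡p ⟨
    1 + (p ∸ 1)           ∎)
    where
    open ≈-Reasoning
    open +-*-Solver

  *-inverse-cancelˡ : ∀ {w m} n → w * m ≈ 1 → w * (m * n) ≈ n
  *-inverse-cancelˡ {w} {m} n w*m≈1 = begin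
    w * (m * n) ≡⟨ *-assoc w m n ⟨
    w * m * n   ≈⟨ *-cong {n = n} w*m≈1 refl ⟩
    1 * n       ≡⟨ *-identityˡ n ⟩
    n           ∎
    where open ≈-Reasoning

  module _ (p-prime : Prime p) where

    ∃-inverse-of-residue : ∀ {r} .{{_ : NonZero r}} → r < p → ∃ λ w → w * r ≈ 1
    ∃-inverse-of-residue {r} r<p with coprime-Bézout (prime⇒coprime p-prime r<p)
    ... | Bézout.-+ x y 1+x*p≡y*r = y , (begin
      y * r     ≡⟨ 1+x*p≡y*r ⟨
      1 + x * p ≈⟨ [m+kn]%n≡m%n 1 x p ⟩
      1         ∎)
      where open ≈-Reasoning
    ... | Bézout.+- x y 1+y*r≡x*p = (p ∸ 1) * y , (begin
      (p ∸ 1) * y * r   ≡⟨ *-assoc (p ∸ 1) y r ⟩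
      (p ∸ 1) * (y * r) ≈⟨ 1+n≈0⇒[p∸1]*n≈1 1+y*r≈0 ⟩
      1                 ∎)
      where
      open ≈-Reasoning
      1+y*r≈0 : 1 + y * r ≈ 0
      1+y*r≈0 = trans (cong (_% p) 1+y*r≡x*p) (trans (m*n%n≡0 x p) (sym 0%p≡0))

    ≉0⇒∃-inverse : ∀ {m} → ¬ m ≈ 0 → ∃ λ w → w * m ≈ 1
    ≉0⇒∃-inverse {m} m≉0 =
      map₂ (λ {w} → w*[m%p]≈1⇒w*m≈1 {w}) (∃-inverse-of-residue {{≢-nonZero m%p≢0}} (m%n<n m p))
      where
      m%p≢0 : ¬ m % p ≡ 0
      m%p≢0 m%p≡0 = m≉0 (trans m%p≡0 (sym 0%p≡0))
      w*[m%p]≈1⇒w*m≈1 : ∀ {w} → w * (m % p) ≈ 1 → w * m ≈ 1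
      w*[m%p]≈1⇒w*m≈1 {w} = trans (*-cong {w} refl (sym (m%n%n≡m%n m p)))

  *-inverse-⇔ : ∀ {w m n o} → w * m ≈ 1 → n ≈ m * o ⇔ o ≈ w * n
  *-inverse-⇔ {w} {m} {n} {o} w*m≈1 = mk⇔
    (λ n≈m*o → begin
      o           ≈⟨ *-inverse-cancelˡ {w} o w*m≈1 ⟨
      w * (m * o) ≈⟨ *-cong {w} refl n≈m*o ⟨
      w * n       ∎)
    (λ o≈w*n → begin
      n           ≈⟨ *-inverse-cancelˡ {m} n m*w≈1 ⟨
      m * (w * n) ≈⟨ *-cong {m} refl o≈w*n ⟨
      m * o       ∎)
    where
    open ≈-Reasoning
    m*w≈1 : m * w ≈ 1
    m*w≈1 = trans (cong (_% p) (*-comm m w)) w*m≈1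

module ZpProperties (p : ℕ) .{{_ : NonZero p}} where
  open Zp p
  open Congruence p

  toℕ-mod : ∀ m → toℕ (m mod p) ≈ m
  toℕ-mod m = trans (cong (_% p) (toℕ-fromℕ< (m%n<n m p))) (m%n%n≡m%n m p)

  ≈⇒≡ : ∀ {u v : Z} → toℕ u ≈ toℕ v → u ≡ v
  ≈⇒≡ {u} {v} u≈v = toℕ-injective (begin
    toℕ u     ≡⟨ m<n⇒m%n≡m (toℕ<n u) ⟨
    toℕ u % p ≡⟨ u≈v ⟩
    toℕ v % p ≡⟨ m<n⇒m%n≡m (toℕ<n v) ⟩
    toℕ v     ∎)
    where open ≡-Reasoning

  ≡⇒≈ : ∀ {u v : Z} → u ≡ v → toℕ u ≈ toℕ v
  ≡⇒≈ refl = refl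

  mod-injective : ∀ {m n} → m < p → n < p → m mod p ≡ n mod p → m ≡ n
  mod-injective {m} {n} m<p n<p m≡n = begin
    m               ≡⟨ m<n⇒m%n≡m m<p ⟨
    m % p           ≡⟨ toℕ-fromℕ< (m%n<n m p) ⟨
    toℕ (m mod p)   ≡⟨ cong toℕ m≡n ⟩
    toℕ (n mod p)   ≡⟨ toℕ-fromℕ< (m%n<n n p) ⟩
    n % p           ≡⟨ m<n⇒m%n≡m n<p ⟩
    n               ∎
    where open ≡-Reasoning

  ≈0⇒≡0ₚ : ∀ {u} → toℕ u ≈ 0 → u ≡ 0ₚ
  ≈0⇒≡0ₚ u≈0 = ≈⇒≡ (trans u≈0 (sym (toℕ-mod 0)))

  +ₚ-identityˡ : ∀ u → 0ₚ +ₚ u ≡ u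
  +ₚ-identityˡ u = ≈⇒≡ (trans (toℕ-mod _) (+-cong (toℕ-mod 0) refl))

  +ₚ-identityʳ : ∀ u → u +ₚ 0ₚ ≡ u
  +ₚ-identityʳ u = ≈⇒≡ (begin
    toℕ (u +ₚ 0ₚ)   ≈⟨ toℕ-mod _ ⟩
    toℕ u + toℕ 0ₚ  ≈⟨ +-cong {toℕ u} refl (toℕ-mod 0) ⟩
    toℕ u + 0       ≡⟨ +-identityʳ (toℕ u) ⟩
    toℕ u           ∎)
    where open ≈-Reasoning

  +ₚ-cancelˡ : ∀ u {v w} → u +ₚ v ≡ u +ₚ w → v ≡ w
  +ₚ-cancelˡ u {v} {w} u+v≡u+w = ≈⇒≡ (+-cancelʳ (toℕ u) (begin
    toℕ v + toℕ u   ≡⟨ +-comm (toℕ v) (toℕ u) ⟩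
    toℕ u + toℕ v   ≈⟨ toℕ-mod _ ⟨
    toℕ (u +ₚ v)    ≡⟨ cong toℕ u+v≡u+w ⟩
    toℕ (u +ₚ w)    ≈⟨ toℕ-mod _ ⟩
    toℕ u + toℕ w   ≡⟨ +-comm (toℕ u) (toℕ w) ⟩
    toℕ w + toℕ u   ∎))
    where open ≈-Reasoning

  *ₚ-zeroʳ : ∀ u → u *ₚ 0ₚ ≡ 0ₚ
  *ₚ-zeroʳ u = ≈0⇒≡0ₚ (begin
    toℕ (u *ₚ 0ₚ)   ≈⟨ toℕ-mod _ ⟩
    toℕ u * toℕ 0ₚ  ≈⟨ *-cong {toℕ u} refl (toℕ-mod 0) ⟩
    toℕ u * 0       ≡⟨ *-zeroʳ (toℕ u) ⟩
    0               ∎)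
    where open ≈-Reasoning

  *ₚ-identityʳ : ∀ u → u *ₚ 1ₚ ≡ u
  *ₚ-identityʳ u = ≈⇒≡ (begin
    toℕ (u *ₚ 1ₚ)   ≈⟨ toℕ-mod _ ⟩
    toℕ u * toℕ 1ₚ  ≈⟨ *-cong {toℕ u} refl (toℕ-mod 1) ⟩
    toℕ u * 1       ≡⟨ *-identityʳ (toℕ u) ⟩
    toℕ u           ∎)
    where open ≈-Reasoning

  1ₚ^ₚk≡1ₚ : ∀ k → 1ₚ ^ₚ k ≡ 1ₚ
  1ₚ^ₚk≡1ₚ zero    = refl
  1ₚ^ₚk≡1ₚ (suc k) = trans (cong (1ₚ *ₚ_) (1ₚ^ₚk≡1ₚ k)) (*ₚ-identityʳ 1ₚ)

  ≈⇔≡mod : ∀ {u m} → toℕ u ≈ m ⇔ u ≡ m mod p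
  ≈⇔≡mod {u} {m} = mk⇔ (λ u≈m → ≈⇒≡ (trans u≈m (sym (toℕ-mod m)))) (λ { refl → toℕ-mod m })

  u+v≡0∧v≡0⇒u≡0 : ∀ {u v} → u +ₚ v ≡ 0ₚ → v ≡ 0ₚ → u ≡ 0ₚ
  u+v≡0∧v≡0⇒u≡0 {u} u+v≡0 refl = trans (sym (+ₚ-identityʳ u)) u+v≡0

  module _ (p-prime : Prime p) where

    *ₚ≡0ₚ⇒≡0ₚ : ∀ {u v} → ¬ u ≡ 0ₚ → u *ₚ v ≡ 0ₚ → v ≡ 0ₚ
    *ₚ≡0ₚ⇒≡0ₚ {u} {v} u≢0 u*v≡0 = ≈0⇒≡0ₚ (begin
      toℕ v               ≈⟨ *-inverse-cancelˡ {w} (toℕ v) w*u≈1 ⟨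
      w * (toℕ u * toℕ v) ≈⟨ *-cong {w} refl u*v≈0 ⟩
      w * 0               ≡⟨ *-zeroʳ w ⟩
      0                   ∎)
      where
      open ≈-Reasoning
      inverse = ≉0⇒∃-inverse p-prime (λ u≈0 → u≢0 (≈0⇒≡0ₚ u≈0))
      w = proj₁ inverse
      w*u≈1 = proj₂ inverse
      u*v≈0 : toℕ u * toℕ v ≈ 0
      u*v≈0 = trans (sym (toℕ-mod _)) (trans (≡⇒≈ u*v≡0) (toℕ-mod 0))

    linear-∃! : ∀ {z} → ¬ z ≡ 1ₚ → ∀ e → ∃! _≡_ (λ t → e +ₚ t ≡ z *ₚ t)
    linear-∃! {z} z≢1 e = t₀ , from (solves⇔ t₀) refl , λ {t} s → sym (to (solves⇔ t) s)
      where
      open Equivalence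
      open ≈-Reasoning
      -- K represents z − 1 without truncated subtraction.
      K = toℕ z + (p ∸ 1)
      z≈1+K : toℕ z ≈ suc K
      z≈1+K = begin
        toℕ z                 ≈⟨ [m+n]%n≡m%n (toℕ z) p ⟨
        toℕ z + p             ≡⟨ cong (toℕ z +_) 1+p∸1≡p ⟨
        toℕ z + suc (p ∸ 1)   ≡⟨ +-suc (toℕ z) (p ∸ 1) ⟩
        suc K                 ∎
      K≉0 : ¬ K ≈ 0
      K≉0 K≈0 = z≢1 (≈⇒≡ (begin
        toℕ z   ≈⟨ z≈1+K ⟩
        1 + K   ≈⟨ +-cong {1} refl K≈0 ⟩
        1       ≈⟨ toℕ-mod 1 ⟨
        toℕ 1ₚ  ∎))
      inverse = ≉0⇒∃-inverse p-prime K≉0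
      w = proj₁ inverse
      t₀ = (w * toℕ e) mod p
      z*t≈K*t+t : ∀ t → toℕ (z *ₚ t) ≈ K * toℕ t + toℕ t
      z*t≈K*t+t t = begin
        toℕ (z *ₚ t)       ≈⟨ toℕ-mod _ ⟩
        toℕ z * toℕ t      ≈⟨ *-cong z≈1+K refl ⟩
        toℕ t + K * toℕ t  ≡⟨ +-comm (toℕ t) (K * toℕ t) ⟩
        K * toℕ t + toℕ t  ∎
      fixed⇔ : ∀ t → e +ₚ t ≡ z *ₚ t ⇔ toℕ e ≈ K * toℕ t
      fixed⇔ t = mk⇔
        (λ s → +-cancelʳ (toℕ t) (trans (sym (toℕ-mod _)) (trans (≡⇒≈ s) (z*t≈K*t+t t))))
        (λ e≈K*t → ≈⇒≡ (trans (toℕ-mod _) (trans (+-cong e≈K*t refl) (sym (z*t≈K*t+t t)))))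
      solves⇔ : ∀ t → e +ₚ t ≡ z *ₚ t ⇔ t ≡ t₀
      solves⇔ t = ⇔-trans (fixed⇔ t) (⇔-trans (*-inverse-⇔ {w} (proj₂ inverse)) ≈⇔≡mod)

  2ₚ≢0ₚ : 2 < p → ¬ 2 mod p ≡ 0ₚ
  2ₚ≢0ₚ 2<p 2≡0 with mod-injective 2<p (>-nonZero⁻¹ p) 2≡0
  ... | ()

  1ₚ≢2ₚ : 2 < p → ¬ 1ₚ ≡ 2 mod p
  1ₚ≢2ₚ 2<p 1≡2 with mod-injective (<-trans (s≤s (s≤s z≤n)) 2<p) 2<p 1≡2
  ... | ()

  generator≢1ₚ : 2 < p → ∀ {x} → IsGenerator x → ¬ x ≡ 1ₚ
  generator≢1ₚ 2<p (_ , generates) refl with generates (2 mod p) (2ₚ≢0ₚ 2<p)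
  ... | k , 1^k≡2 = 1ₚ≢2ₚ 2<p (trans (sym (1ₚ^ₚk≡1ₚ k)) 1^k≡2)

  *ₚ≡1ₚ⇒≢1ₚ : ∀ {u v} → u *ₚ v ≡ 1ₚ → ¬ u ≡ 1ₚ → ¬ v ≡ 1ₚ
  *ₚ≡1ₚ⇒≢1ₚ {u} u*v≡1 u≢1 refl = u≢1 (trans (sym (*ₚ-identityʳ u)) u*v≡1)

module Agreement (p : ℕ) .{{_ : NonZero p}} (p-prime : Prime p) {x : Zp.Z p}
                 (x≢0 : ¬ x ≡ Zp.0ₚ p) (x≢1 : ¬ x ≡ Zp.1ₚ p) where
  open Zp p
  open ZpProperties p

  x*d≡0⇒d≡0 : ∀ {d} → x *ₚ d ≡ 0ₚ → d ≡ 0ₚ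
  x*d≡0⇒d≡0 = *ₚ≡0ₚ⇒≡0ₚ p-prime x≢0

  b≡x*b⇒b≡0 : ∀ {b} → b ≡ x *ₚ b → b ≡ 0ₚ
  b≡x*b⇒b≡0 {b} b≡x*b = trans (sym (unique b-solves)) (unique 0-solves)
    where
    unique = proj₂ (proj₂ (linear-∃! p-prime x≢1 0ₚ))
    b-solves : 0ₚ +ₚ b ≡ x *ₚ b
    b-solves = trans (+ₚ-identityˡ b) b≡x*b
    0-solves : 0ₚ +ₚ 0ₚ ≡ x *ₚ 0ₚ
    0-solves = trans (+ₚ-identityˡ 0ₚ) (sym (*ₚ-zeroʳ x))

  0+b+d≡b+d : ∀ b d → 0ₚ +ₚ b +ₚ d ≡ b +ₚ d
  0+b+d≡b+d b d = cong (_+ₚ d) (+ₚ-identityˡ b)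

  agreement-c≡0-abd≢0 : ∀ a b d →
    (a ≡ 0ₚ × a +ₚ b +ₚ d ≡ x *ₚ d) ⇔ (a ≡ 0ₚ × b +ₚ d ≡ x *ₚ d)
  agreement-c≡0-abd≢0 a b d = mk⇔
    (λ { (refl , s) → refl , trans (sym (0+b+d≡b+d b d)) s })
    (λ { (refl , s) → refl , trans (0+b+d≡b+d b d) s })

  agreement-c≡0-abd≡0 : ∀ a b d → a +ₚ b +ₚ d ≡ 0ₚ →
    (a +ₚ x *ₚ b ≡ 0ₚ × 0ₚ ≡ x *ₚ d) ⇔ (a ≡ 0ₚ × b +ₚ d ≡ x *ₚ d)
  agreement-c≡0-abd≡0 a b d a+b+d≡0 = mk⇔
    (λ (a+xb≡0 , 0≡xd) →
      let d≡0 = x*d≡0⇒d≡0 (sym 0≡xd)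
          a+b≡0 = u+v≡0∧v≡0⇒u≡0 a+b+d≡0 d≡0
          b≡0 = b≡x*b⇒b≡0 (+ₚ-cancelˡ a (trans a+b≡0 (sym a+xb≡0)))
      in u+v≡0∧v≡0⇒u≡0 a+b≡0 b≡0 , trans (trans (cong₂ _+ₚ_ b≡0 d≡0) (+ₚ-identityˡ 0ₚ)) 0≡xd)
    (λ { (refl , b+d≡xd) →
      let b+d≡0 = trans (sym (0+b+d≡b+d b d)) a+b+d≡0
          b≡0 = u+v≡0∧v≡0⇒u≡0 b+d≡0 (x*d≡0⇒d≡0 (trans (sym b+d≡xd) b+d≡0))
      in trans (+ₚ-identityˡ _) (trans (cong (x *ₚ_) b≡0) (*ₚ-zeroʳ x)) , trans (sym b+d≡0) b+d≡xd })

  agreement-c≢0-bd≡0 : ∀ y a b c d → b +ₚ d ≡ 0ₚ →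
    (a +ₚ c +ₚ x *ₚ b ≡ y *ₚ c × 0ₚ ≡ x *ₚ d) ⇔ (a +ₚ c ≡ y *ₚ c × b +ₚ d ≡ x *ₚ d)
  agreement-c≢0-bd≡0 y a b c d b+d≡0 = mk⇔
    (λ (s , 0≡xd) → trans (sym (a+c+xb≡a+c 0≡xd)) s , trans b+d≡0 0≡xd)
    (λ (s , b+d≡xd) →
      let 0≡xd = trans (sym b+d≡0) b+d≡xd
      in trans (a+c+xb≡a+c 0≡xd) s , 0≡xd)
    where
    a+c+xb≡a+c : 0ₚ ≡ x *ₚ d → a +ₚ c +ₚ x *ₚ b ≡ a +ₚ c
    a+c+xb≡a+c 0≡xd = begin
      a +ₚ c +ₚ x *ₚ b  ≡⟨ cong (λ u → a +ₚ c +ₚ x *ₚ u) b≡0 ⟩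
      a +ₚ c +ₚ x *ₚ 0ₚ ≡⟨ cong (a +ₚ c +ₚ_) (*ₚ-zeroʳ x) ⟩
      a +ₚ c +ₚ 0ₚ      ≡⟨ +ₚ-identityʳ (a +ₚ c) ⟩
      a +ₚ c            ∎
      where
      open ≡-Reasoning
      b≡0 = u+v≡0∧v≡0⇒u≡0 b+d≡0 (x*d≡0⇒d≡0 (sym 0≡xd))

  agreement⇔ : ∀ y a b c d →
    πab x (a , b) (c , d) ≡ π x y (c , d) ⇔ (a +ₚ c ≡ y *ₚ c × b +ₚ d ≡ x *ₚ d)
  agreement⇔ y a b c d with c ≟ 0ₚ | a +ₚ b +ₚ d ≟ 0ₚ | b +ₚ d ≟ 0ₚ
  ... | yes refl | no _        | _ rewrite *ₚ-zeroʳ y | +ₚ-identityʳ a =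
    ⇔-trans ,≡,⇔ (agreement-c≡0-abd≢0 a b d)
  ... | yes refl | yes a+b+d≡0 | _ rewrite *ₚ-zeroʳ y | +ₚ-identityʳ a =
    ⇔-trans ,≡,⇔ (agreement-c≡0-abd≡0 a b d a+b+d≡0)
  ... | no _     | _           | yes b+d≡0 = ⇔-trans ,≡,⇔ (agreement-c≢0-bd≡0 y a b c d b+d≡0)
  ... | no _     | _           | no _      = ,≡,⇔

proposition1 : (p : ℕ) → .{{_ : NonZero p}} → Prime p → 5 ≤ p →
    (x y : Zp.Z p) → Zp.IsGenerator p x → Zp._*ₚ_ p x y ≡ Zp.1ₚ p →
    (a b : Zp.Z p) →
      ∃! _≡_ (λ (cd : Zp.I p) → Zp.πab p x (a , b) cd ≡ Zp.π p x y cd)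
proposition1 p p-prime 5≤p x y generator x*y≡1 a b =
  ∃!-⇔ (λ (c , d) → agreement⇔ y a b c d)
       (∃!-× (linear-∃! p-prime (*ₚ≡1ₚ⇒≢1ₚ x*y≡1 x≢1) a) (linear-∃! p-prime x≢1 b))
  where
  open Zp p
  open ZpProperties p

  x≢1 : ¬ x ≡ 1ₚ
  x≢1 = generator≢1ₚ (≤-trans (s≤s (s≤s (s≤s z≤n))) 5≤p) generator

  open Agreement p p-prime (proj₁ generator) x≢1
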